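{- For $n\ge 3$, the Kneser graph $K(n,2)$ satisfies $\mathrm{gp}^-(K(n,2))=3$ if $n\in\{3,6,7\}$; $=4$ if $n\in\{5,8,9\}$; $=5$ if $n\in\{10,11\}$; and $=6$ otherwise.
   Context: $K(n,2)$ has as vertices the 2-element subsets of $\{1,\dots,n\}$, two being adjacent iff disjoint. A set $S$ of vertices of a graph $G$ is a general position set if no shortest path contains three or more vertices of $S$; it is maximal if not properly contained in another general position set; $\mathrm{gp}^-(G)$ is the number of vertices in a smallest maximal general position set. -}

module Defs where

open import Data.Nat using (ℕ; zero; suc; _≤_)
open import Data.Fin using (Fin)
import Data.Fin as F
open import Data.Product using (Σ; Σ-syntax; _,_; _×_; ∃-syntax)
open import Data.List using (List; []; _∷_; length)
open import Data.List.Membership.Propositional using (_∈_)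
open import Data.List.Relation.Unary.Unique.Propositional using (Unique)
open import Data.Empty using (⊥)
open import Relation.Nullary using (¬_)
open import Relation.Binary.PropositionalEquality using (_≡_; _≢_)

-- Vertices of K(n,2): 2-element subsets {a,b} of an n-element ground set
-- (here Fin n), represented canonically as a pair with a < b.
KV : ℕ → Set
KV n = Σ[ a ∈ Fin n ] Σ[ b ∈ Fin n ] a F.< b

fst : ∀ {n} → KV n → Fin n
fst (a , _ , _) = a

snd : ∀ {n} → KV n → Fin n
snd (_ , b , _) = b

Adj : ∀ {n} → KV n → KV n → Set
Adj u v = (fst u ≢ fst v) × (fst u ≢ snd v) × (snd u ≢ fst v) × (snd u ≢ snd v)

data Walk {n : ℕ} : KV n → KV n → ℕ → Set where
  stay : ∀ {u} → Walk u u 0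
  step : ∀ {u w v k} → Adj u w → Walk w v k → Walk u v (suc k)

verts : ∀ {n} {u v : KV n} {k} → Walk u v k → List (KV n)
verts {u = u} stay = u ∷ []
verts {u = u} (step _ p) = u ∷ verts p

IsShortest : ∀ {n} {u v : KV n} {k} → Walk u v k → Set
IsShortest {n} {u} {v} {k} _ = ∀ k' → Walk u v k' → k ≤ k'

IsGP : ∀ {n} → List (KV n) → Set
IsGP {n} S = ∀ {u v : KV n} {k} (p : Walk u v k) → IsShortest p →
  ∀ x y z → x ∈ S → y ∈ S → z ∈ S → x ≢ y → y ≢ z → x ≢ z →
  x ∈ verts p → y ∈ verts p → z ∈ verts p → ⊥

_⊆_ : ∀ {A : Set} → List A → List A → Set
S ⊆ T = ∀ {x} → x ∈ S → x ∈ T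

IsMaximalGP : ∀ {n} → List (KV n) → Set
IsMaximalGP {n} S = IsGP S × (∀ (T : List (KV n)) → IsGP T → S ⊆ T → T ⊆ S)

GpMinusIs : ℕ → ℕ → Set
GpMinusIs n m =
  (∃[ S ] (Unique S × IsMaximalGP {n} S × length S ≡ m)) ×
  (∀ (S : List (KV n)) → Unique S → IsMaximalGP S → m ≤ length S)

module Submission where

-- A vertex {a, b} of K(n,2) is an edge of the complete graph on the ground set, so a vertex set S
-- is a graph on the ground set, and two vertices are adjacent iff the edges are disjoint. For
-- n ≥ 5 the diameter is 2, so S is in general position iff it contains no geodesic x – y – z:
-- two distinct edges x, z sharing a point and an edge y disjoint from both.
--
-- Lower bound: a general position set S with |S| ≤ 5 and 2|S| + 2 ≤ n (or n = 5, |S| ≤ 3) is not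
-- maximal. A matching takes one more disjoint edge, a star one more edge at its centre; otherwise
-- S contains a path c–a–b–d or a triangle, and then every edge of S lies inside four points, so
-- one of the six edges on those points is missing and can be added.
--
-- Upper bound: the six edges on four points form a maximal general position set, and for
-- 5 ≤ n ≤ 11 a star or a near-perfect matching is maximal (checked by evaluation). For n = 3, 4
-- every set is in general position, so gp⁻ is the number of vertices.

open import Defs
open import Data.Nat using (ℕ; zero; suc; _≤_; _<_; _+_; _*_; z≤n; s≤s)
import Data.Nat.Properties as ℕ
open import Data.Fin as F using (Fin; zero; suc; #_)
import Data.Fin.Properties as FinP
open import Data.Product using (_×_; ∃; _,_; proj₁; proj₂)
open import Data.Sum using (_⊎_; inj₁; inj₂; [_,_])
open import Data.Empty using (⊥; ⊥-elim)
open import Function using (case_of_; _∘_)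
open import Relation.Nullary using (¬_; Dec; yes; no; ¬?; contradiction)
open import Relation.Nullary.Decidable using (True; toWitness; from-yes; from-no; _×-dec_; _⊎-dec_; decidable-stable)
open import Relation.Binary.Definitions using (DecidableEquality; tri<; tri≈; tri>)
open import Relation.Binary.PropositionalEquality using (_≡_; _≢_; refl; sym; trans; cong; subst; ≢-sym)

open import Data.List using (List; []; _∷_; length; map; allFin; concatMap)
open import Data.List.Properties using (length-tabulate; length-map)
open import Data.List.Membership.Propositional using (_∈_; _∉_; find; lose)
open import Data.List.Membership.Propositional.Properties using (∈-allFin; ∈-concatMap⁺; ∈-map⁺; ∈-map⁻; ∈-++⁺ˡ)
open import Data.List.Relation.Unary.Any using (Any; here; there)
import Data.List.Relation.Unary.Any as Any
open import Data.List.Relation.Unary.All using (All; []; _∷_)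
import Data.List.Relation.Unary.All as All
open import Data.List.Relation.Unary.All.Properties using (¬All⇒Any¬; ¬Any⇒All¬)
open import Data.List.Relation.Unary.AllPairs using ([]; _∷_)
open import Data.List.Relation.Unary.Unique.Propositional using (Unique)
open import Data.List.Relation.Unary.Unique.Propositional.Properties using (allFin⁺; map⁺)
open import Data.List.Relation.Unary.Unique.DecPropositional using (unique?)

open import Data.Vec as Vec using (Vec; []; _∷_)
open import Data.Vec.Properties using (length-toList)
open import Data.Vec.Membership.Propositional.Properties using (∈-lookup; ∈-toList⁺; ∈-toList⁻)
import Data.Vec.Relation.Unary.Any as Vecᵃ
open import Data.Vec.Relation.Unary.Any.Properties using (lookup-index)
import Data.Vec.Relation.Unary.All.Properties as Vecᴬ
open import Data.Vec.Relation.Unary.AllPairs using ([]; _∷_)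
import Data.Vec.Relation.Unary.Unique.Propositional as Vecᵘ
open import Data.Vec.Relation.Unary.Unique.Propositional.Properties using (lookup-injective)

module _ {A : Set} (_≟_ : DecidableEquality A) where
  open import Data.List.Membership.DecPropositional _≟_ using (_∈?_)

  private
    remove : A → List A → List A
    remove x [] = []
    remove x (y ∷ ys) with x ≟ y
    ... | yes _ = ys
    ... | no _  = y ∷ remove x ys

    length-remove : ∀ {x} ys → x ∈ ys → suc (length (remove x ys)) ≡ length ys
    length-remove {x} (y ∷ ys) x∈ with x ≟ y | x∈
    ... | yes _  | _          = refl
    ... | no x≢y | here x≡y   = contradiction x≡y x≢y
    ... | no _   | there x∈ys = cong suc (length-remove ys x∈ys)

    ∈-remove : ∀ {x z} ys → z ∈ ys → z ≢ x → z ∈ remove x ys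
    ∈-remove {x} (y ∷ ys) z∈ z≢x with x ≟ y | z∈
    ... | yes refl | here z≡x   = contradiction z≡x z≢x
    ... | yes refl | there z∈ys = z∈ys
    ... | no _     | here z≡y   = here z≡y
    ... | no _     | there z∈ys = there (∈-remove ys z∈ys z≢x)

  Unique-⊆⇒length≤ : ∀ {L M : List A} → Unique L → L ⊆ M → length L ≤ length M
  Unique-⊆⇒length≤ {[]}    _          _   = z≤n
  Unique-⊆⇒length≤ {x ∷ L} {M} (x∉L ∷ uL) L⊆M =
    subst (suc (length L) ≤_) (length-remove M (L⊆M (here refl)))
      (s≤s (Unique-⊆⇒length≤ uL λ t∈L →
        ∈-remove M (L⊆M (there t∈L)) (λ t≡x → All.lookup x∉L t∈L (sym t≡x))))

  Unique-⊆-length≥⇒⊇ : ∀ {L M : List A} → Unique L → L ⊆ M → length M ≤ length L → M ⊆ L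
  Unique-⊆-length≥⇒⊇ {L} {M} uL L⊆M M≤L {t} t∈M with t ∈? L
  ... | yes t∈L = t∈L
  ... | no  t∉L = contradiction M≤L (ℕ.<⇒≱ (subst (length L <_) (length-remove M t∈M)
        (s≤s (Unique-⊆⇒length≤ uL λ s∈L → ∈-remove M (L⊆M s∈L) λ { refl → t∉L s∈L }))))

distinct₄ : ∀ {A : Set} {p q r s : A} → p ≢ q → p ≢ r → p ≢ s → q ≢ r → q ≢ s → r ≢ s →
            Unique (p ∷ q ∷ r ∷ s ∷ [])
distinct₄ p≢q p≢r p≢s q≢r q≢s r≢s = (p≢q ∷ p≢r ∷ p≢s ∷ []) ∷ (q≢r ∷ q≢s ∷ []) ∷ (r≢s ∷ []) ∷ [] ∷ []

⊆-triple : ∀ {A : Set} {x y z : A} {L} → x ∈ L → y ∈ L → z ∈ L → (x ∷ y ∷ z ∷ []) ⊆ L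
⊆-triple x∈L _   _   (here refl)                 = x∈L
⊆-triple _   y∈L _   (there (here refl))         = y∈L
⊆-triple _   _   z∈L (there (there (here refl))) = z∈L

module _ {n : ℕ} where
  open import Data.List.Membership.DecPropositional (FinP._≟_ {n}) using (_∈?_)

  Unique⇒length≤ : {L : List (Fin n)} → Unique L → length L ≤ n
  Unique⇒length≤ {L} uL = subst (length L ≤_) (length-tabulate (λ i → i))
    (Unique-⊆⇒length≤ FinP._≟_ uL (λ {t} _ → ∈-allFin t))

  ∃∉ : (L : List (Fin n)) → length L < n → ∃ λ f → f ∉ L
  ∃∉ L |L|<n with All.all? (_∈? L) (allFin n)
  ... | yes all∈L = contradiction (subst (_≤ length L) (length-tabulate {n = n} (λ i → i))
                                     (Unique-⊆⇒length≤ FinP._≟_ (allFin⁺ n) (All.lookup all∈L)))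
                                   (ℕ.<⇒≱ |L|<n)
  ... | no ¬all = let (f , _ , f∉L) = find (¬All⇒Any¬ (_∈? L) (allFin n) ¬all) in f , f∉L

-- Vertices of K(n,2) as two-element subsets

infix 4 _∋_
-- An inductive family rather than a sum of equations, so that v can be recovered by unification.
data _∋_ {n} (v : KV n) : Fin n → Set where
  ∋fst : v ∋ fst v
  ∋snd : v ∋ snd v

IsPair : ∀ {n} → KV n → Fin n → Fin n → Set
IsPair v a b = v ∋ a × v ∋ b × a ≢ b

Meets : ∀ {n} → KV n → KV n → Set
Meets u v = ∃ λ t → u ∋ t × v ∋ t

module _ {n : ℕ} where

  fst≢snd : (v : KV n) → fst v ≢ snd v
  fst≢snd (_ , _ , a<b) = FinP.<⇒≢ a<b

  IsPair-fst-snd : (v : KV n) → IsPair v (fst v) (snd v)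
  IsPair-fst-snd v = ∋fst , ∋snd , fst≢snd v

  ∋-≡ : ∀ {v : KV n} {a b t} → v ∋ a → v ∋ b → a ≢ b → v ∋ t → t ≡ a ⊎ t ≡ b
  ∋-≡ ∋fst ∋fst a≢b _    = contradiction refl a≢b
  ∋-≡ ∋snd ∋snd a≢b _    = contradiction refl a≢b
  ∋-≡ ∋fst ∋snd _   ∋fst = inj₁ refl
  ∋-≡ ∋fst ∋snd _   ∋snd = inj₂ refl
  ∋-≡ ∋snd ∋fst _   ∋fst = inj₂ refl
  ∋-≡ ∋snd ∋fst _   ∋snd = inj₁ refl

  IsPair-∋ : ∀ {v : KV n} {a b t} → IsPair v a b → v ∋ t → t ≡ a ⊎ t ≡ b
  IsPair-∋ (v∋a , v∋b , a≢b) = ∋-≡ v∋a v∋b a≢b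

  IsPair-sym : ∀ {v : KV n} {a b} → IsPair v a b → IsPair v b a
  IsPair-sym (v∋a , v∋b , a≢b) = v∋b , v∋a , ≢-sym a≢b

  ∋⇒IsPair : ∀ {v : KV n} {t} → v ∋ t → ∃ λ s → IsPair v s t
  ∋⇒IsPair {v} ∋fst = snd v , ∋snd , ∋fst , ≢-sym (fst≢snd v)
  ∋⇒IsPair {v} ∋snd = fst v , IsPair-fst-snd v

  ⊆⇒≡ : ∀ {u v : KV n} → (∀ {t} → u ∋ t → v ∋ t) → u ≡ v
  ⊆⇒≡ {a , b , a<b} {c , d , c<d} u⊆v with u⊆v ∋fst | u⊆v ∋snd
  ... | ∋fst | ∋fst = contradiction refl (FinP.<⇒≢ a<b)
  ... | ∋fst | ∋snd = cong (λ p → a , b , p) (FinP.<-irrelevant a<b c<d)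
  ... | ∋snd | ∋fst = contradiction c<d (FinP.<-asym a<b)
  ... | ∋snd | ∋snd = contradiction refl (FinP.<⇒≢ a<b)

  IsPair-unique : ∀ {u v : KV n} {a b} → IsPair u a b → IsPair v a b → u ≡ v
  IsPair-unique pu (v∋a , v∋b , _) = ⊆⇒≡ λ u∋t → case IsPair-∋ pu u∋t of λ where
    (inj₁ refl) → v∋a
    (inj₂ refl) → v∋b

  pair : (a b : Fin n) → a ≢ b → ∃ λ v → IsPair v a b
  pair a b a≢b with FinP.<-cmp a b
  ... | tri< a<b _ _ = (a , b , a<b) , ∋fst , ∋snd , a≢b
  ... | tri≈ _ a≡b _ = contradiction a≡b a≢b
  ... | tri> _ _ b<a = (b , a , b<a) , ∋snd , ∋fst , a≢b

  _≟ᵥ_ : DecidableEquality (KV n)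
  (a , b , a<b) ≟ᵥ (c , d , c<d) with a FinP.≟ c | b FinP.≟ d
  ... | yes refl | yes refl = yes (cong (λ p → a , b , p) (FinP.<-irrelevant a<b c<d))
  ... | no a≢c   | _        = no λ { refl → a≢c refl }
  ... | yes _    | no b≢d   = no λ { refl → b≢d refl }

  Adj⇒¬Meets : ∀ {u v : KV n} → Adj u v → ¬ Meets u v
  Adj⇒¬Meets (ff , fs , sf , ss) (_ , ∋fst , ∋fst) = ff refl
  Adj⇒¬Meets (ff , fs , sf , ss) (_ , ∋fst , ∋snd) = fs refl
  Adj⇒¬Meets (ff , fs , sf , ss) (_ , ∋snd , ∋fst) = sf refl
  Adj⇒¬Meets (ff , fs , sf , ss) (_ , ∋snd , ∋snd) = ss refl

  ¬Meets⇒Adj : (u v : KV n) → ¬ Meets u v → Adj u v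
  ¬Meets⇒Adj u v u∩v=∅ =
      (λ e → u∩v=∅ (_ , ∋fst , subst (v ∋_) (sym e) ∋fst))
    , (λ e → u∩v=∅ (_ , ∋fst , subst (v ∋_) (sym e) ∋snd))
    , (λ e → u∩v=∅ (_ , ∋snd , subst (v ∋_) (sym e) ∋fst))
    , (λ e → u∩v=∅ (_ , ∋snd , subst (v ∋_) (sym e) ∋snd))

  meets? : (u v : KV n) → Dec (Meets u v)
  meets? u v with fst u FinP.≟ fst v | fst u FinP.≟ snd v | snd u FinP.≟ fst v | snd u FinP.≟ snd v
  ... | yes e | _     | _     | _     = yes (_ , ∋fst , subst (v ∋_) (sym e) ∋fst)
  ... | _     | yes e | _     | _     = yes (_ , ∋fst , subst (v ∋_) (sym e) ∋snd)
  ... | _     | _     | yes e | _     = yes (_ , ∋snd , subst (v ∋_) (sym e) ∋fst)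
  ... | _     | _     | _     | yes e = yes (_ , ∋snd , subst (v ∋_) (sym e) ∋snd)
  ... | no ff | no fs | no sf | no ss = no (Adj⇒¬Meets (ff , fs , sf , ss))

  Meets-sym : ∀ {u v : KV n} → Meets u v → Meets v u
  Meets-sym (t , u∋t , v∋t) = t , v∋t , u∋t

  ¬Meets⇒≢ : ∀ {u v : KV n} → ¬ Meets u v → u ≢ v
  ¬Meets⇒≢ u∩v=∅ refl = u∩v=∅ (_ , ∋fst , ∋fst)

  IsPair-∌ : ∀ {v : KV n} {a b t} → IsPair v a b → t ≢ a → t ≢ b → ¬ v ∋ t
  IsPair-∌ v=ab t≢a t≢b v∋t = [ t≢a , t≢b ] (IsPair-∋ v=ab v∋t)

  Meets-IsPair : ∀ {x y : KV n} {a b} → IsPair x a b → Meets y x → y ∋ a ⊎ y ∋ b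
  Meets-IsPair x=ab (t , y∋t , x∋t) with IsPair-∋ x=ab x∋t
  ... | inj₁ refl = inj₁ y∋t
  ... | inj₂ refl = inj₂ y∋t

  _∋?_ : (v : KV n) (t : Fin n) → Dec (v ∋ t)
  v ∋? t with fst v FinP.≟ t | snd v FinP.≟ t
  ... | yes refl | _        = yes ∋fst
  ... | no _     | yes refl = yes ∋snd
  ... | no f≢t   | no s≢t   = no λ { ∋fst → f≢t refl ; ∋snd → s≢t refl }

  ≢⇒∃∌ : ∀ {u v : KV n} → u ≢ v → ∃ λ t → v ∋ t × ¬ u ∋ t
  ≢⇒∃∌ {u} {v} u≢v with u ∋? fst v | u ∋? snd v
  ... | no u∌f  | _        = fst v , ∋fst , u∌f
  ... | yes _   | no u∌s   = snd v , ∋snd , u∌s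
  ... | yes u∋f | yes u∋s  = contradiction (sym (⊆⇒≡ λ { ∋fst → u∋f ; ∋snd → u∋s })) u≢v

  ∌⇒≢ : ∀ {u : KV n} {a t} → u ∋ a → ¬ u ∋ t → a ≢ t
  ∌⇒≢ u∋a u∌t refl = u∌t u∋a

  ¬Meets⇒∋≢ : ∀ {u v : KV n} {a b} → ¬ Meets u v → u ∋ a → v ∋ b → a ≢ b
  ¬Meets⇒∋≢ u∩v=∅ u∋a v∋b refl = u∩v=∅ (_ , u∋a , v∋b)

  ∃-avoiding : (C : List (Fin n)) → 2 + length C ≤ n → ∃ λ w → ∀ {t} → w ∋ t → t ∉ C
  ∃-avoiding C 2+|C|≤n with ∃∉ C (ℕ.≤-trans (ℕ.n≤1+n _) 2+|C|≤n)
  ... | f , f∉C with ∃∉ (f ∷ C) 2+|C|≤n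
  ...   | g , g∉f∷C with pair f g (λ f≡g → g∉f∷C (here (sym f≡g)))
  ...     | w , w=fg = w , λ w∋t → case IsPair-∋ w=fg w∋t of λ where
    (inj₁ refl) → f∉C
    (inj₂ refl) → g∉f∷C ∘ there

  common-neighbour : 5 ≤ n → ∀ {u v : KV n} → Meets u v → ∃ λ w → ¬ Meets u w × ¬ Meets w v
  common-neighbour 5≤n {u} {v} (t , u∋t , v∋t) with ∋⇒IsPair v∋t
  ... | s , v=st with ∃-avoiding (fst u ∷ snd u ∷ s ∷ []) 5≤n
  ...   | w , w∌C = w , (λ (r , u∋r , w∋r) → w∌C w∋r (∈u u∋r))
                     , (λ (r , w∋r , v∋r) → w∌C w∋r (∈v (IsPair-∋ v=st v∋r)))
    where
    ∈u : ∀ {r} → u ∋ r → r ∈ fst u ∷ snd u ∷ s ∷ []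
    ∈u ∋fst = here refl
    ∈u ∋snd = there (here refl)
    ∈v : ∀ {r} → r ≡ s ⊎ r ≡ t → r ∈ fst u ∷ snd u ∷ s ∷ []
    ∈v (inj₁ refl) = there (there (here refl))
    ∈v (inj₂ refl) = ∈u u∋t

  distance≤2 : 5 ≤ n → (u v : KV n) → ∃ λ k → k ≤ 2 × Walk u v k
  distance≤2 5≤n u v with u ≟ᵥ v | meets? u v
  ... | yes refl | _       = 0 , z≤n , stay
  ... | no _     | no u∩v=∅ = 1 , s≤s z≤n , step (¬Meets⇒Adj u v u∩v=∅) stay
  ... | no _     | yes u∩v with common-neighbour 5≤n u∩v
  ...   | w , u∩w=∅ , w∩v=∅ =
    2 , s≤s (s≤s z≤n) , step {w = w} (¬Meets⇒Adj u w u∩w=∅) (step (¬Meets⇒Adj w v w∩v=∅) stay)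

pairsFrom : ∀ {n} → Fin n → List (Fin n) → List (KV n)
pairsFrom a [] = []
pairsFrom a (b ∷ bs) with a F.<? b
... | yes a<b = (a , b , a<b) ∷ pairsFrom a bs
... | no _    = pairsFrom a bs

allKV : ∀ n → List (KV n)
allKV n = concatMap (λ a → pairsFrom a (allFin n)) (allFin n)

module _ {n : ℕ} where

  ∈-pairsFrom : ∀ {a b : Fin n} (a<b : a F.< b) {bs} → b ∈ bs → (a , b , a<b) ∈ pairsFrom a bs
  ∈-pairsFrom {a} {b} a<b {b′ ∷ bs} b∈ with a F.<? b′ | b∈
  ... | yes a<b′ | here refl = here (cong (λ p → a , b , p) (FinP.<-irrelevant a<b a<b′))
  ... | yes _    | there b∈bs = there (∈-pairsFrom a<b b∈bs)
  ... | no a≮b′  | here refl = contradiction a<b a≮b′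
  ... | no _     | there b∈bs = ∈-pairsFrom a<b b∈bs

  ∈-allKV : (v : KV n) → v ∈ allKV n
  ∈-allKV (a , b , a<b) =
    ∈-concatMap⁺ (λ a → pairsFrom a (allFin n)) (lose (∈-allFin a) (∈-pairsFrom a<b (∈-allFin b)))

edge : ∀ {n} (a b : Fin n) → {True (a F.<? b)} → KV n
edge a b {a<b} = a , b , toWitness a<b

e₀₁ e₀₂ e₀₃ e₁₂ e₁₃ e₂₃ : ∀ {m} → KV (4 + m)
e₀₁ = edge (# 0) (# 1)
e₀₂ = edge (# 0) (# 2)
e₀₃ = edge (# 0) (# 3)
e₁₂ = edge (# 1) (# 2)
e₁₃ = edge (# 1) (# 3)
e₂₃ = edge (# 2) (# 3)

e₂₄ : ∀ {m} → KV (5 + m)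
e₂₄ = edge (# 2) (# 4)

-- Geodesics and general position

Geodesic : ∀ {n} → KV n → KV n → KV n → Set
Geodesic x y z = x ≢ z × Meets x z × ¬ Meets x y × ¬ Meets y z

GeodesicFree : ∀ {n} → List (KV n) → Set
GeodesicFree S = ∀ {x y z} → x ∈ S → y ∈ S → z ∈ S → ¬ Geodesic x y z

geodesic? : ∀ {n} (x y z : KV n) → Dec (Geodesic x y z)
geodesic? x y z = ¬? (x ≟ᵥ z) ×-dec meets? x z ×-dec ¬? (meets? x y) ×-dec ¬? (meets? y z)

length-verts : ∀ {n} {u v : KV n} {k} (p : Walk u v k) → length (verts p) ≡ suc k
length-verts stay       = refl
length-verts (step _ p) = cong suc (length-verts p)

module _ {n : ℕ} {S : List (KV n)} where

  IsGP⇒GeodesicFree : IsGP S → GeodesicFree S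
  IsGP⇒GeodesicFree gp {x} {y} {z} x∈S y∈S z∈S (x≢z , x∩z , x∩y=∅ , y∩z=∅) =
    gp xyz shortest x y z x∈S y∈S z∈S (¬Meets⇒≢ x∩y=∅) (¬Meets⇒≢ y∩z=∅) x≢z
       (here refl) (there (here refl)) (there (there (here refl)))
    where
    xyz : Walk x z 2
    xyz = step {w = y} (¬Meets⇒Adj x y x∩y=∅) (step (¬Meets⇒Adj y z y∩z=∅) stay)
    shortest : IsShortest xyz
    shortest 0 stay                  = contradiction refl x≢z
    shortest 1 (step x~z stay)       = contradiction x∩z (Adj⇒¬Meets x~z)
    shortest (suc (suc _)) _         = s≤s (s≤s z≤n)

  -- As the diameter is 2, three distinct vertices on a shortest path are all of its vertices.
  GeodesicFree⇒IsGP : 5 ≤ n → GeodesicFree S → IsGP S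
  GeodesicFree⇒IsGP 5≤n gf {u} {v} {k} p shortest x y z x∈S y∈S z∈S x≢y y≢z x≢z x∈p y∈p z∈p =
    on-path p shortest k≤2 (⊆-triple x∈p y∈p z∈p)
    where
    k≤2 : k ≤ 2
    k≤2 = let (k′ , k′≤2 , q) = distance≤2 5≤n u v in ℕ.≤-trans (shortest k′ q) k′≤2
    xyz-unique : Unique (x ∷ y ∷ z ∷ [])
    xyz-unique = (x≢y ∷ x≢z ∷ []) ∷ (y≢z ∷ []) ∷ [] ∷ []
    three≤ : ∀ {L : List (KV n)} → (x ∷ y ∷ z ∷ []) ⊆ L → 3 ≤ length L
    three≤ = Unique-⊆⇒length≤ _≟ᵥ_ xyz-unique
    on-path : ∀ {k} (p : Walk u v k) → IsShortest p → k ≤ 2 → (x ∷ y ∷ z ∷ []) ⊆ verts p → ⊥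
    on-path stay _ _ ⊆p = contradiction (three≤ ⊆p) λ { (s≤s ()) }
    on-path (step _ stay) _ _ ⊆p = contradiction (three≤ ⊆p) λ { (s≤s (s≤s ())) }
    on-path (step _ (step _ (step _ _))) _ (s≤s (s≤s ())) _
    on-path (step {w = w} u~w (step w~v stay)) shortest _ ⊆p =
      gf (uwv⊆S (here refl)) (uwv⊆S (there (here refl))) (uwv⊆S (there (there (here refl))))
         (u≢v , u∩v , Adj⇒¬Meets u~w , Adj⇒¬Meets w~v)
      where
      uwv⊆S : (u ∷ w ∷ v ∷ []) ⊆ S
      uwv⊆S = ⊆-triple x∈S y∈S z∈S ∘ Unique-⊆-length≥⇒⊇ _≟ᵥ_ xyz-unique ⊆p ℕ.≤-refl
      u≢v : u ≢ v
      u≢v refl = contradiction (shortest 0 stay) λ ()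
      u∩v : Meets u v
      u∩v with meets? u v
      ... | yes u∩v = u∩v
      ... | no u∩v=∅ = contradiction (shortest 1 (step (¬Meets⇒Adj u v u∩v=∅) stay)) λ { (s≤s ()) }

-- Sets supported on four points

Supported : ∀ {n} → List (Fin n) → List (KV n) → Set
Supported W S = ∀ {x t} → x ∈ S → x ∋ t → t ∈ W

Extendable : ∀ {n} → List (KV n) → Set
Extendable {n} S = ∃ λ (v : KV n) → v ∉ S × GeodesicFree (v ∷ S)

module _ {n : ℕ} where
  open import Data.List.Membership.DecPropositional (FinP._≟_ {n}) using (_∈?_)

  private
    ends∈? : (W : List (Fin n)) (f : KV n) → Dec (fst f ∈ W × snd f ∈ W)
    ends∈? W f = (fst f ∈? W) ×-dec (snd f ∈? W)

  supported-or-escapes : (W : List (Fin n)) (S : List (KV n)) →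
                         Supported W S ⊎ ∃ λ f → f ∈ S × ∃ λ t → f ∋ t × t ∉ W
  supported-or-escapes W S with All.all? (ends∈? W) S
  ... | yes ends∈W = inj₁ λ x∈S → λ where
    ∋fst → proj₁ (All.lookup ends∈W x∈S)
    ∋snd → proj₂ (All.lookup ends∈W x∈S)
  ... | no ¬ends∈W with find (¬All⇒Any¬ (ends∈? W) S ¬ends∈W)
  ...   | f , f∈S , ¬both∈W with fst f ∈? W
  ...     | no fst∉W  = inj₂ (f , f∈S , fst f , ∋fst , fst∉W)
  ...     | yes fst∈W = inj₂ (f , f∈S , snd f , ∋snd , λ snd∈W → ¬both∈W (fst∈W , snd∈W))

  -- y, x and the point of z outside x would be five distinct points of W.
  Supported⇒GeodesicFree : ∀ {W : List (Fin n)} {S} → length W ≤ 4 → Supported W S → GeodesicFree S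
  Supported⇒GeodesicFree {W} |W|≤4 sup {x} {y} {z} x∈S y∈S z∈S (x≢z , _ , x∩y=∅ , y∩z=∅) with ≢⇒∃∌ x≢z
  ... | o , z∋o , x∌o = contradiction (ℕ.≤-trans (Unique-⊆⇒length≤ FinP._≟_ five-unique five⊆W) |W|≤4)
                          λ { (s≤s (s≤s (s≤s (s≤s ())))) }
    where
    y≢x : ∀ {a b} → y ∋ a → x ∋ b → a ≢ b
    y≢x = ¬Meets⇒∋≢ (x∩y=∅ ∘ Meets-sym)
    y≢o : ∀ {a} → y ∋ a → a ≢ o
    y≢o y∋a = ¬Meets⇒∋≢ y∩z=∅ y∋a z∋o
    five-unique : Unique (fst y ∷ snd y ∷ fst x ∷ snd x ∷ o ∷ [])
    five-unique = (fst≢snd y ∷ y≢x ∋fst ∋fst ∷ y≢x ∋fst ∋snd ∷ y≢o ∋fst ∷ [])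
                ∷ (y≢x ∋snd ∋fst ∷ y≢x ∋snd ∋snd ∷ y≢o ∋snd ∷ [])
                ∷ (fst≢snd x ∷ ∌⇒≢ ∋fst x∌o ∷ [])
                ∷ (∌⇒≢ ∋snd x∌o ∷ [])
                ∷ [] ∷ []
    five⊆W : (fst y ∷ snd y ∷ fst x ∷ snd x ∷ o ∷ []) ⊆ W
    five⊆W (here refl) = sup y∈S ∋fst
    five⊆W (there (here refl)) = sup y∈S ∋snd
    five⊆W (there (there (here refl))) = sup x∈S ∋fst
    five⊆W (there (there (there (here refl)))) = sup x∈S ∋snd
    five⊆W (there (there (there (there (here refl))))) = sup z∈S z∋o

toList⁻-Unique : ∀ {A : Set} {m} {V : Vec A m} → Unique (Vec.toList V) → Vecᵘ.Unique V
toList⁻-Unique {V = []}    []         = []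
toList⁻-Unique {V = _ ∷ _} (x∉ ∷ uV) = Vecᴬ.toList⁻ x∉ ∷ toList⁻-Unique uV

-- m distinct points embed K(m,2) into K(n,2), preserving meeting, disjointness and geodesics, so
-- configurations on a few named points can be decided by evaluation in K(m,2).
module Lift {n m : ℕ} (V : Vec (Fin n) m) (V-unique : Unique (Vec.toList V)) where

  ι : Fin m → Fin n
  ι = Vec.lookup V

  ι-injective : ∀ {i j} → ι i ≡ ι j → i ≡ j
  ι-injective = lookup-injective (toList⁻-Unique V-unique) _ _

  W : List (Fin n)
  W = Vec.toList V

  ι∈W : ∀ i → ι i ∈ W
  ι∈W i = ∈-toList⁺ (∈-lookup i V)

  ∈W⇒ι : ∀ {t} → t ∈ W → ∃ λ i → t ≡ ι i
  ∈W⇒ι t∈W = let t∈V = ∈-toList⁻ t∈W in Vecᵃ.index t∈V , lookup-index t∈V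

  lifted : (s : KV m) → ∃ λ v → IsPair v (ι (fst s)) (ι (snd s))
  lifted (i , j , i<j) = pair (ι i) (ι j) (FinP.<⇒≢ i<j ∘ ι-injective)

  lift : KV m → KV n
  lift = proj₁ ∘ lifted

  IsPair-lift : (s : KV m) → IsPair (lift s) (ι (fst s)) (ι (snd s))
  IsPair-lift s = proj₂ (lifted s)

  lift-∋ : ∀ {s i} → s ∋ i → lift s ∋ ι i
  lift-∋ {s} ∋fst = proj₁ (proj₂ (lifted s))
  lift-∋ {s} ∋snd = proj₁ (proj₂ (proj₂ (lifted s)))

  lift-∋⁻ : ∀ {s i} → lift s ∋ ι i → s ∋ i
  lift-∋⁻ {s} lift∋ι with IsPair-∋ (proj₂ (lifted s)) lift∋ι
  ... | inj₁ e = subst (s ∋_) (sym (ι-injective e)) ∋fst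
  ... | inj₂ e = subst (s ∋_) (sym (ι-injective e)) ∋snd

  lift-∋-∈W : ∀ {s t} → lift s ∋ t → t ∈ W
  lift-∋-∈W {s} lift∋t with IsPair-∋ (proj₂ (lifted s)) lift∋t
  ... | inj₁ refl = ι∈W (fst s)
  ... | inj₂ refl = ι∈W (snd s)

  lift-injective : ∀ {s u} → lift s ≡ lift u → s ≡ u
  lift-injective eq = ⊆⇒≡ λ s∋i → lift-∋⁻ (subst (_∋ _) eq (lift-∋ s∋i))

  lift-¬Meets : ∀ {s u} → ¬ Meets s u → ¬ Meets (lift s) (lift u)
  lift-¬Meets {s} s∩u=∅ (t , ls∋t , lu∋t) with ∈W⇒ι (lift-∋-∈W {s} ls∋t)
  ... | i , refl = s∩u=∅ (i , lift-∋⁻ ls∋t , lift-∋⁻ lu∋t)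

  lift-Meets : ∀ {s u} → Meets s u → Meets (lift s) (lift u)
  lift-Meets {s} {u} (i , s∋i , u∋i) = ι i , lift-∋ {s} s∋i , lift-∋ {u} u∋i

  lift-Geodesic : ∀ {s u r} → Geodesic s u r → Geodesic (lift s) (lift u) (lift r)
  lift-Geodesic (s≢r , s∩r , s∩u=∅ , u∩r=∅) =
    s≢r ∘ lift-injective , lift-Meets s∩r , lift-¬Meets s∩u=∅ , lift-¬Meets u∩r=∅

opposite-edges : (i : Fin 4) → ∃ λ s → ∃ λ s′ → s ∋ i × ¬ Meets s s′
opposite-edges zero                   = e₀₁ , e₂₃ , ∋fst , from-no (meets? e₀₁ e₂₃)
opposite-edges (suc zero)             = e₀₁ , e₂₃ , ∋snd , from-no (meets? e₀₁ e₂₃)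
opposite-edges (suc (suc zero))       = e₂₃ , e₀₁ , ∋fst , from-no (meets? e₂₃ e₀₁)
opposite-edges (suc (suc (suc zero))) = e₂₃ , e₀₁ , ∋snd , from-no (meets? e₂₃ e₀₁)

module Frame {n : ℕ} (V : Vec (Fin n) 4) (V-unique : Unique (Vec.toList V)) where
  open Lift V V-unique public
  open import Data.List.Membership.DecPropositional (_≟ᵥ_ {n}) using (_∈?_)
  open import Data.List.Membership.DecPropositional (FinP._≟_ {n}) using () renaming (_∈?_ to _∈ᶠ?_)

  K₄ : List (KV n)
  K₄ = map lift (allKV 4)

  K₄-unique : Unique K₄
  K₄-unique = map⁺ lift-injective (from-yes (unique? _≟ᵥ_ (allKV 4)))

  K₄-supported : Supported W K₄
  K₄-supported x∈K₄ x∋t with ∈-map⁻ lift {xs = allKV 4} x∈K₄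
  ... | s , _ , refl = lift-∋-∈W {s} x∋t

  ∈-K₄ : ∀ {u} → (∀ {t} → u ∋ t → t ∈ W) → u ∈ K₄
  ∈-K₄ {u} u⊆W with ∈W⇒ι (u⊆W ∋fst) | ∈W⇒ι (u⊆W ∋snd)
  ... | i , refl | j , snd≡ιj with subst (IsPair u (ι i)) snd≡ιj (IsPair-fst-snd u)
  ...   | u=ιiιj@(_ , _ , ιi≢ιj) with pair i j (ιi≢ιj ∘ cong ι)
  ...     | s , s∋i , s∋j , _ = subst (_∈ K₄) (IsPair-unique (lift-∋ s∋i , lift-∋ s∋j , ιi≢ιj) u=ιiιj)
                                  (∈-map⁺ lift (∈-allKV s))

  Supported⇒Extendable : ∀ {S} → length S ≤ 5 → Supported W S → Extendable S
  Supported⇒Extendable {S} |S|≤5 S⊆W with All.all? (_∈? S) K₄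
  ... | yes K₄⊆S = contradiction (Unique-⊆⇒length≤ _≟ᵥ_ K₄-unique (All.lookup K₄⊆S)) (ℕ.<⇒≱ (s≤s |S|≤5))
  ... | no K₄⊈S with find (¬All⇒Any¬ (_∈? S) K₄ K₄⊈S)
  ...   | v , v∈K₄ , v∉S = v , v∉S , Supported⇒GeodesicFree (ℕ.≤-reflexive (length-toList V)) v∷S⊆W
    where
    v∷S⊆W : Supported W (v ∷ S)
    v∷S⊆W (here refl) = K₄-supported v∈K₄
    v∷S⊆W (there x∈S) = S⊆W x∈S

  private
    lift∈ : ∀ {T} → K₄ ⊆ T → ∀ s → lift s ∈ T
    lift∈ K₄⊆T s = K₄⊆T (∈-map⁺ lift (∈-allKV s))

  ¬one-end-in-W : ∀ {T t a r} → GeodesicFree T → K₄ ⊆ T → t ∈ T → t ∋ a → t ∋ r → a ∈ W → r ∉ W → ⊥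
  ¬one-end-in-W {t = t} {r = r} gf K₄⊆T t∈T t∋a t∋r a∈W r∉W with ∈W⇒ι a∈W
  ... | i , refl with opposite-edges i
  ...   | s , s′ , s∋i , s∩s′=∅ =
    gf t∈T (lift∈ K₄⊆T s′) (lift∈ K₄⊆T s)
       (t≢ls , (ι i , t∋a , lift-∋ s∋i) , t∩ls′=∅ , lift-¬Meets (s∩s′=∅ ∘ Meets-sym))
    where
    t≢ls : t ≢ lift s
    t≢ls refl = r∉W (lift-∋-∈W {s} t∋r)
    t∩ls′=∅ : ¬ Meets t (lift s′)
    t∩ls′=∅ (p , t∋p , ls′∋p) with ∋-≡ t∋a t∋r (λ { refl → r∉W a∈W }) t∋p
    ... | inj₁ refl = s∩s′=∅ (i , s∋i , lift-∋⁻ ls′∋p)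
    ... | inj₂ refl = r∉W (lift-∋-∈W {s′} ls′∋p)

  ¬no-end-in-W : ∀ {T t} → GeodesicFree T → K₄ ⊆ T → t ∈ T → (∀ {p} → t ∋ p → p ∉ W) → ⊥
  ¬no-end-in-W {t = t} gf K₄⊆T t∈T t∩W=∅ =
    gf (lift∈ K₄⊆T e₀₁) t∈T (lift∈ K₄⊆T e₀₂)
       (from-no (e₀₁ ≟ᵥ e₀₂) ∘ lift-injective , (ι zero , lift-∋ {e₀₁} ∋fst , lift-∋ {e₀₂} ∋fst) ,
        avoids {e₀₁} ∘ Meets-sym , avoids {e₀₂})
    where
    avoids : ∀ {s} → ¬ Meets t (lift s)
    avoids {s} (p , t∋p , ls∋p) = t∩W=∅ t∋p (lift-∋-∈W {s} ls∋p)

  K₄-maximal : ∀ {T} → GeodesicFree T → K₄ ⊆ T → T ⊆ K₄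
  K₄-maximal gf K₄⊆T {t} t∈T with fst t ∈ᶠ? W | snd t ∈ᶠ? W
  ... | yes f∈W | yes s∈W = ∈-K₄ {t} λ { ∋fst → f∈W ; ∋snd → s∈W }
  ... | yes f∈W | no s∉W  = ⊥-elim (¬one-end-in-W gf K₄⊆T t∈T ∋fst ∋snd f∈W s∉W)
  ... | no f∉W  | yes s∈W = ⊥-elim (¬one-end-in-W gf K₄⊆T t∈T ∋snd ∋fst s∈W f∉W)
  ... | no f∉W  | no s∉W  = ⊥-elim (¬no-end-in-W gf K₄⊆T t∈T λ { ∋fst → f∉W ; ∋snd → s∉W })

  K₄-maximalGP : 5 ≤ n → IsMaximalGP K₄
  K₄-maximalGP 5≤n =
      GeodesicFree⇒IsGP 5≤n (Supported⇒GeodesicFree (ℕ.≤-reflexive (length-toList V)) K₄-supported)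
    , λ T gp → K₄-maximal (IsGP⇒GeodesicFree gp)

-- Extending small general position sets

module _ {n : ℕ} where

  partner : Fin n → KV n → Fin n
  partner a v with fst v FinP.≟ a
  ... | yes _ = snd v
  ... | no _  = fst v

  partner-IsPair : ∀ {v : KV n} {a b} → IsPair v a b → partner a v ≡ b
  partner-IsPair {v} {a} v=ab with fst v FinP.≟ a | IsPair-∋ v=ab ∋fst | IsPair-∋ v=ab ∋snd
  ... | yes _     | _          | inj₂ snd≡b = snd≡b
  ... | yes fst≡a | _          | inj₁ snd≡a = contradiction (trans fst≡a (sym snd≡a)) (fst≢snd v)
  ... | no _      | inj₂ fst≡b | _          = fst≡b
  ... | no fst≢a  | inj₁ fst≡a | _          = contradiction fst≡a fst≢a

  star-GeodesicFree : ∀ {a} {T : List (KV n)} → (∀ {x} → x ∈ T → x ∋ a) → GeodesicFree T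
  star-GeodesicFree all∋a x∈T y∈T _ (_ , _ , x∩y=∅ , _) = x∩y=∅ (_ , all∋a x∈T , all∋a y∈T)

  star-extendable : ∀ {a} {S : List (KV n)} → (∀ {x} → x ∈ S → x ∋ a) → 2 + length S ≤ n → Extendable S
  star-extendable {a} {S} all∋a 2+|S|≤n
    with ∃∉ (a ∷ map (partner a) S) (subst (λ k → 2 + k ≤ n) (sym (length-map (partner a) S)) 2+|S|≤n)
  ... | f , f∉ with pair a f (f∉ ∘ here ∘ sym)
  ...   | v , v=af = v , v∉S , star-GeodesicFree λ { (here refl) → proj₁ v=af ; (there x∈S) → all∋a x∈S }
    where
    v∉S : v ∉ S
    v∉S v∈S = f∉ (there (subst (_∈ map (partner a) S) (partner-IsPair v=af) (∈-map⁺ (partner a) v∈S)))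

Matching : ∀ {n} → List (KV n) → Set
Matching S = ∀ {x z} → x ∈ S → z ∈ S → x ≢ z → ¬ Meets x z

ends : ∀ {n} → List (KV n) → List (Fin n)
ends []      = []
ends (v ∷ S) = fst v ∷ snd v ∷ ends S

module _ {n : ℕ} where

  Matching⇒GeodesicFree : ∀ {S : List (KV n)} → Matching S → GeodesicFree S
  Matching⇒GeodesicFree matching x∈S _ z∈S (x≢z , x∩z , _) = matching x∈S z∈S x≢z x∩z

  length-ends : (S : List (KV n)) → length (ends S) ≡ 2 * length S
  length-ends []      = refl
  length-ends (v ∷ S) = trans (cong (2 +_) (length-ends S)) (sym (ℕ.*-suc 2 (length S)))

  ∈-ends : ∀ {S : List (KV n)} {x t} → x ∈ S → x ∋ t → t ∈ ends S
  ∈-ends (here refl) ∋fst = here refl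
  ∈-ends (here refl) ∋snd = there (here refl)
  ∈-ends (there x∈S) x∋t  = there (there (∈-ends x∈S x∋t))

  ∈-ends⁻ : ∀ {S : List (KV n)} {t} → t ∈ ends S → ∃ λ y → y ∈ S × y ∋ t
  ∈-ends⁻ {v ∷ _} (here refl)         = v , here refl , ∋fst
  ∈-ends⁻ {v ∷ _} (there (here refl)) = v , here refl , ∋snd
  ∈-ends⁻ {v ∷ _} (there (there t∈))  = let (y , y∈S , y∋t) = ∈-ends⁻ t∈ in y , there y∈S , y∋t

  ends-unique : ∀ {S : List (KV n)} → Unique S → Matching S → Unique (ends S)
  ends-unique {[]}    _            _        = []
  ends-unique {x ∷ S} (x∉S ∷ uS) matching =
    (fst≢snd x ∷ All.tabulate (apart ∋fst)) ∷ All.tabulate (apart ∋snd)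
      ∷ ends-unique uS (λ y∈S z∈S → matching (there y∈S) (there z∈S))
    where
    apart : ∀ {a t} → x ∋ a → t ∈ ends S → a ≢ t
    apart x∋a t∈ends with ∈-ends⁻ t∈ends
    ... | y , y∈S , y∋t = ¬Meets⇒∋≢ (matching (here refl) (there y∈S) (All.lookup x∉S y∈S)) x∋a y∋t

  matching-extendable : ∀ {S : List (KV n)} → Matching S → 2 + 2 * length S ≤ n → Extendable S
  matching-extendable {S} matching 2+2|S|≤n
    with ∃-avoiding (ends S) (subst (λ k → 2 + k ≤ n) (sym (length-ends S)) 2+2|S|≤n)
  ... | w , w∌ends = w , (λ w∈S → w∌ends ∋fst (∈-ends w∈S ∋fst)) , Matching⇒GeodesicFree w∷S-matching
    where
    w∷S-matching : Matching (w ∷ S)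
    w∷S-matching (here refl) (here refl) w≢w _               = w≢w refl
    w∷S-matching (here refl) (there z∈S) _   (t , w∋t , z∋t) = w∌ends w∋t (∈-ends z∈S z∋t)
    w∷S-matching (there x∈S) (here refl) _   (t , x∋t , w∋t) = w∌ends w∋t (∈-ends x∈S x∋t)
    w∷S-matching (there x∈S) (there z∈S) x≢z x∩z             = matching x∈S z∈S x≢z x∩z

  ≡-or-disjoint? : (x z : KV n) → Dec (x ≡ z ⊎ ¬ Meets x z)
  ≡-or-disjoint? x z = (x ≟ᵥ z) ⊎-dec ¬? (meets? x z)

  matching? : (S : List (KV n)) → Matching S ⊎ ∃ λ x → ∃ λ z → x ∈ S × z ∈ S × x ≢ z × Meets x z
  matching? S with All.all? (λ x → All.all? (≡-or-disjoint? x) S) S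
  ... | yes ok = inj₁ λ x∈S z∈S x≢z → case All.lookup (All.lookup ok x∈S) z∈S of λ where
    (inj₁ x≡z)   → ⊥-elim (x≢z x≡z)
    (inj₂ x∩z=∅) → x∩z=∅
  ... | no ¬ok with find (¬All⇒Any¬ (λ x → All.all? (≡-or-disjoint? x) S) S ¬ok)
  ...   | x , x∈S , ¬all with find (¬All⇒Any¬ (≡-or-disjoint? x) S ¬all)
  ...     | z , z∈S , ¬[x≡z⊎x∩z=∅] =
    inj₂ (x , z , x∈S , z∈S , ¬[x≡z⊎x∩z=∅] ∘ inj₁ , decidable-stable (meets? x z) (¬[x≡z⊎x∩z=∅] ∘ inj₂))

module _ {n : ℕ} {S : List (KV n)} (gf : GeodesicFree S) where
  open import Data.List.Membership.DecPropositional (FinP._≟_ {n}) using (_∈?_)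

  meets-one-of : ∀ {x z y} → x ∈ S → z ∈ S → x ≢ z → Meets x z → y ∈ S → Meets y x ⊎ Meets y z
  meets-one-of {x} {z} {y} x∈S z∈S x≢z x∩z y∈S with meets? y x | meets? y z
  ... | yes y∩x  | _        = inj₁ y∩x
  ... | no _     | yes y∩z  = inj₂ y∩z
  ... | no y∩x=∅ | no y∩z=∅ = ⊥-elim (gf x∈S y∈S z∈S (x≢z , x∩z , y∩x=∅ ∘ Meets-sym , y∩z=∅))

  -- An edge f through a point t ∉ {a,b,c,d} meets x or z, hence contains a, b or c; each case gives
  -- a geodesic, found by evaluation in K(5,2) on the points t, a, b, c, d.
  path₃-supported : ∀ {a b c d x z e} → Unique (a ∷ b ∷ c ∷ d ∷ []) → x ∈ S → z ∈ S → e ∈ S →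
                    IsPair x a b → IsPair z a c → IsPair e b d → Supported (a ∷ b ∷ c ∷ d ∷ []) S
  path₃-supported {a} {b} {c} {d} abcd-unique x∈S z∈S e∈S x=ab z=ac e=bd {f} {t} f∈S f∋t
    with t ∈? (a ∷ b ∷ c ∷ d ∷ [])
  ... | yes t∈abcd = t∈abcd
  ... | no t∉abcd  = ⊥-elim (case meets-one-of x∈S′ z∈S′ (from-no (e₁₂ ≟ᵥ e₁₃) ∘ lift-injective)
                                   (lift-Meets (from-yes (meets? e₁₂ e₁₃))) f∈S of λ where
      (inj₁ f∩x) → [ through-a , through-b ] (Meets-IsPair (IsPair-lift e₁₂) f∩x)
      (inj₂ f∩z) → [ through-a , through-c ] (Meets-IsPair (IsPair-lift e₁₃) f∩z))
    where
    open Lift (t ∷ a ∷ b ∷ c ∷ d ∷ []) (¬Any⇒All¬ _ t∉abcd ∷ abcd-unique)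
    lift∈S : ∀ {y} s → y ∈ S → IsPair y (ι (fst s)) (ι (snd s)) → lift s ∈ S
    lift∈S s y∈S y=s = subst (_∈ S) (IsPair-unique y=s (IsPair-lift s)) y∈S
    x∈S′ : lift e₁₂ ∈ S
    x∈S′ = lift∈S e₁₂ x∈S x=ab
    z∈S′ : lift e₁₃ ∈ S
    z∈S′ = lift∈S e₁₃ z∈S z=ac
    e∈S′ : lift e₂₄ ∈ S
    e∈S′ = lift∈S e₂₄ e∈S e=bd
    through-a : f ∋ a → ⊥
    through-a f∋a = gf (lift∈S e₀₁ f∈S (f∋t , f∋a , t∉abcd ∘ here)) e∈S′ z∈S′
                       (lift-Geodesic (from-yes (geodesic? e₀₁ e₂₄ e₁₃)))
    through-b : f ∋ b → ⊥
    through-b f∋b = gf (lift∈S e₀₂ f∈S (f∋t , f∋b , t∉abcd ∘ there ∘ here)) z∈S′ e∈S′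
                       (lift-Geodesic (from-yes (geodesic? e₀₂ e₁₃ e₂₄)))
    through-c : f ∋ c → ⊥
    through-c f∋c = gf x∈S′ (lift∈S e₀₃ f∈S (f∋t , f∋c , t∉abcd ∘ there ∘ there ∘ here)) e∈S′
                       (lift-Geodesic (from-yes (geodesic? e₁₂ e₀₃ e₂₄)))

  -- An edge f leaving the triangle abc forms a path of three edges with two of its sides.
  triangle-extendable : 4 ≤ n → length S ≤ 5 → ∀ {a b c x z e} → x ∈ S → z ∈ S → e ∈ S →
                        IsPair x a b → IsPair z a c → IsPair e b c → Extendable S
  triangle-extendable 4≤n |S|≤5 {a} {b} {c} {x} {z} x∈S z∈S e∈S
                      x=ab@(_ , x∋b , a≢b) z=ac@(_ , _ , a≢c) e=bc@(_ , _ , b≢c)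
    with supported-or-escapes (a ∷ b ∷ c ∷ []) S
  ... | inj₁ S⊆abc with ∃∉ (a ∷ b ∷ c ∷ []) 4≤n
  ...   | d , d∉abc = Frame.Supported⇒Extendable (a ∷ b ∷ c ∷ d ∷ [])
                        (distinct₄ a≢b a≢c (d∉abc ∘ here ∘ sym) b≢c (d∉abc ∘ there ∘ here ∘ sym)
                                   (d∉abc ∘ there ∘ there ∘ here ∘ sym))
                        |S|≤5 λ x∈S x∋t → ∈-++⁺ˡ (S⊆abc x∈S x∋t)
  triangle-extendable 4≤n |S|≤5 {a} {b} {c} {x} {z} x∈S z∈S e∈S
                      x=ab@(_ , x∋b , a≢b) z=ac@(_ , _ , a≢c) e=bc@(_ , _ , b≢c)
    | inj₂ (f , f∈S , t , f∋t , t∉abc) =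
    case meets-one-of x∈S z∈S x≢z (a , proj₁ x=ab , proj₁ z=ac) f∈S of λ where
      (inj₁ f∩x) → [ via-a , via-b ] (Meets-IsPair x=ab f∩x)
      (inj₂ f∩z) → [ via-a , via-c ] (Meets-IsPair z=ac f∩z)
    where
    t≢a : t ≢ a
    t≢a = t∉abc ∘ here
    t≢b : t ≢ b
    t≢b = t∉abc ∘ there ∘ here
    t≢c : t ≢ c
    t≢c = t∉abc ∘ there ∘ there ∘ here
    x≢z : x ≢ z
    x≢z refl = IsPair-∌ z=ac (≢-sym a≢b) b≢c x∋b
    via-a : f ∋ a → Extendable S
    via-a f∋a = Frame.Supported⇒Extendable _ abtc-unique |S|≤5
                  (path₃-supported abtc-unique x∈S f∈S e∈S x=ab (f∋a , f∋t , ≢-sym t≢a) e=bc)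
      where
      abtc-unique : Unique (a ∷ b ∷ t ∷ c ∷ [])
      abtc-unique = distinct₄ a≢b (≢-sym t≢a) a≢c (≢-sym t≢b) b≢c t≢c
    via-b : f ∋ b → Extendable S
    via-b f∋b = Frame.Supported⇒Extendable _ batc-unique |S|≤5
                  (path₃-supported batc-unique x∈S f∈S z∈S (IsPair-sym x=ab) (f∋b , f∋t , ≢-sym t≢b) z=ac)
      where
      batc-unique : Unique (b ∷ a ∷ t ∷ c ∷ [])
      batc-unique = distinct₄ (≢-sym a≢b) (≢-sym t≢b) b≢c (≢-sym t≢a) a≢c t≢c
    via-c : f ∋ c → Extendable S
    via-c f∋c = Frame.Supported⇒Extendable _ catb-unique |S|≤5
                  (path₃-supported catb-unique z∈S f∈S x∈S (IsPair-sym z=ac) (f∋c , f∋t , ≢-sym t≢c) x=ab)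
      where
      catb-unique : Unique (c ∷ a ∷ t ∷ b ∷ [])
      catb-unique = distinct₄ (≢-sym a≢c) (≢-sym t≢c) (≢-sym b≢c) (≢-sym t≢a) a≢b t≢b

  -- With x = {a,b} and z = {a,c}: either S is a star at a, or some e ∌ a meets x or z, so
  -- e = {b,d} or {c,d}, giving a triangle or a path c–a–b–d.
  meeting-extendable : 4 ≤ n → length S ≤ 5 → 2 + length S ≤ n →
                       ∀ {x z} → x ∈ S → z ∈ S → x ≢ z → Meets x z → Extendable S
  meeting-extendable 4≤n |S|≤5 2+|S|≤n {x} {z} x∈S z∈S x≢z (a , x∋a , z∋a) with All.all? (_∋? a) S
  ... | yes all∋a = star-extendable (All.lookup all∋a) 2+|S|≤n
  ... | no ¬all∋a with find (¬All⇒Any¬ (_∋? a) S ¬all∋a)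
  ...   | e , e∈S , e∌a =
    case meets-one-of x∈S z∈S x≢z (a , x∋a , z∋a) e∈S of λ where
      (inj₁ e∩x) → [ ⊥-elim ∘ e∌a , branch x∈S z∈S x=ab z=ac b≢c ] (Meets-IsPair x=ab e∩x)
      (inj₂ e∩z) → [ ⊥-elim ∘ e∌a , branch z∈S x∈S z=ac x=ab (≢-sym b≢c) ] (Meets-IsPair z=ac e∩z)
    where
    b c : Fin n
    b = proj₁ (∋⇒IsPair x∋a)
    c = proj₁ (∋⇒IsPair z∋a)
    x=ab : IsPair x a b
    x=ab = IsPair-sym (proj₂ (∋⇒IsPair x∋a))
    z=ac : IsPair z a c
    z=ac = IsPair-sym (proj₂ (∋⇒IsPair z∋a))
    b≢c : b ≢ c
    b≢c b≡c = x≢z (IsPair-unique x=ab (subst (IsPair z a) (sym b≡c) z=ac))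
    branch : ∀ {y w p q} → y ∈ S → w ∈ S → IsPair y a p → IsPair w a q → p ≢ q → e ∋ p → Extendable S
    branch {p = p} {q} y∈S w∈S y=ap@(_ , _ , a≢p) w=aq@(_ , _ , a≢q) p≢q e∋p with ∋⇒IsPair e∋p
    ... | d , e=dp@(e∋d , _ , d≢p) with d FinP.≟ q
    ...   | yes refl = triangle-extendable 4≤n |S|≤5 y∈S w∈S e∈S y=ap w=aq (IsPair-sym e=dp)
    ...   | no d≢q   = Frame.Supported⇒Extendable _ apqd-unique |S|≤5
                         (path₃-supported apqd-unique y∈S w∈S e∈S y=ap w=aq (IsPair-sym e=dp))
      where
      apqd-unique : Unique (a ∷ p ∷ q ∷ d ∷ [])
      apqd-unique = distinct₄ a≢p a≢q (λ { refl → e∌a e∋d }) p≢q (≢-sym d≢p) (≢-sym d≢q)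

  extendable : 4 ≤ n → length S ≤ 5 → 2 + 2 * length S ≤ n → Extendable S
  extendable 4≤n |S|≤5 2+2|S|≤n with matching? S
  ... | inj₁ matching = matching-extendable matching 2+2|S|≤n
  ... | inj₂ (x , z , x∈S , z∈S , x≢z , x∩z) =
    meeting-extendable 4≤n |S|≤5 (ℕ.≤-trans (ℕ.+-monoʳ-≤ 2 (ℕ.m≤m+n (length S) _)) 2+2|S|≤n) x∈S z∈S x≢z x∩z

-- In K(5,2) a matching has at most two edges, and two disjoint edges span four points.
matching-extendable₅ : (S : List (KV 5)) → Unique S → Matching S → length S ≤ 3 → Extendable S
matching-extendable₅ []              _  matching _ = matching-extendable matching (ℕ.m≤m+n 2 3)
matching-extendable₅ (_ ∷ [])        _  matching _ = matching-extendable matching (ℕ.n≤1+n 4)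
matching-extendable₅ (_ ∷ _ ∷ [])    uS matching _ =
  Frame.Supported⇒Extendable _ (ends-unique uS matching) (ℕ.m≤m+n 2 3) ∈-ends
matching-extendable₅ (_ ∷ _ ∷ _ ∷ _) uS matching _ =
  contradiction (Unique⇒length≤ (ends-unique uS matching)) λ { (s≤s (s≤s (s≤s (s≤s (s≤s ()))))) }

extendable₅ : ∀ {S : List (KV 5)} → Unique S → GeodesicFree S → length S ≤ 3 → Extendable S
extendable₅ {S} uS gf |S|≤3 with matching? S
... | inj₁ matching = matching-extendable₅ S uS matching |S|≤3
... | inj₂ (x , z , x∈S , z∈S , x≢z , x∩z) =
  meeting-extendable gf (ℕ.n≤1+n 4) (ℕ.≤-trans |S|≤3 (ℕ.m≤m+n 3 2)) (s≤s (s≤s |S|≤3)) x∈S z∈S x≢z x∩z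

module _ {n : ℕ} where

  IsMaximalGP⇒¬Extendable : 5 ≤ n → ∀ {S : List (KV n)} → IsMaximalGP S → ¬ Extendable S
  IsMaximalGP⇒¬Extendable 5≤n {S} (_ , maximal) (v , v∉S , gf) =
    v∉S (maximal (v ∷ S) (GeodesicFree⇒IsGP 5≤n gf) there (here refl))

  small-extendable⇒length≥ : 5 ≤ n → ∀ m →
    (∀ {S : List (KV n)} → Unique S → GeodesicFree S → length S < m → Extendable S) →
    ∀ S → Unique S → IsMaximalGP S → m ≤ length S
  small-extendable⇒length≥ 5≤n m small⇒extendable S uS maximal@(gp , _) with m ℕ.≤? length S
  ... | yes m≤|S| = m≤|S|
  ... | no m≰|S|  = ⊥-elim (IsMaximalGP⇒¬Extendable 5≤n maximal
                      (small⇒extendable uS (IsGP⇒GeodesicFree gp) (ℕ.≰⇒> m≰|S|)))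

  IsMaximalGP⇒length≥ : 5 ≤ n → ∀ m → m ≤ 6 → 2 * m ≤ n →
    ∀ (S : List (KV n)) → Unique S → IsMaximalGP S → m ≤ length S
  IsMaximalGP⇒length≥ 5≤n m m≤6 2m≤n = small-extendable⇒length≥ 5≤n m λ {S} _ gf |S|<m →
    extendable gf (ℕ.≤-trans (ℕ.n≤1+n 4) 5≤n) (ℕ.≤-pred (ℕ.≤-trans |S|<m m≤6))
      (ℕ.≤-trans (ℕ.≤-reflexive (sym (ℕ.*-suc 2 (length S)))) (ℕ.≤-trans (ℕ.*-monoʳ-≤ 2 |S|<m) 2m≤n))

IsMaximalGP⇒length≥₅ : ∀ (S : List (KV 5)) → Unique S → IsMaximalGP S → 4 ≤ length S
IsMaximalGP⇒length≥₅ =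
  small-extendable⇒length≥ ℕ.≤-refl 4 λ uS gf |S|<4 → extendable₅ uS gf (ℕ.≤-pred |S|<4)

-- Maximal general position sets and the value of gp⁻

Blocked : ∀ {n} → List (KV n) → KV n → Set
Blocked S t = t ∈ S ⊎ Any (λ x → Any (λ z → Geodesic x t z ⊎ Geodesic t x z) S) S

GeodesicFreeᵃ : ∀ {n} → List (KV n) → Set
GeodesicFreeᵃ S = All (λ x → All (λ y → All (λ z → ¬ Geodesic x y z) S) S) S

module _ {n : ℕ} where
  open import Data.List.Membership.DecPropositional (_≟ᵥ_ {n}) using (_∈?_)

  blocked? : (S : List (KV n)) (t : KV n) → Dec (Blocked S t)
  blocked? S t = (t ∈? S) ⊎-dec Any.any? (λ x → Any.any? (λ z → geodesic? x t z ⊎-dec geodesic? t x z) S) S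

  geodesicFreeᵃ? : (S : List (KV n)) → Dec (GeodesicFreeᵃ S)
  geodesicFreeᵃ? S = All.all? (λ x → All.all? (λ y → All.all? (λ z → ¬? (geodesic? x y z)) S) S) S

  GeodesicFreeᵃ⇒GeodesicFree : ∀ {S : List (KV n)} → GeodesicFreeᵃ S → GeodesicFree S
  GeodesicFreeᵃ⇒GeodesicFree gfᵃ x∈S y∈S z∈S = All.lookup (All.lookup (All.lookup gfᵃ x∈S) y∈S) z∈S

  all-blocked⇒maximal : ∀ {S : List (KV n)} → All (Blocked S) (allKV n) →
                        ∀ T → IsGP T → S ⊆ T → T ⊆ S
  all-blocked⇒maximal blocked T gp S⊆T {t} t∈T with All.lookup blocked (∈-allKV t)
  ... | inj₁ t∈S = t∈S
  ... | inj₂ geodesic-through-t with find geodesic-through-t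
  ...   | x , x∈S , geodesic-x with find geodesic-x
  ...     | z , z∈S , inj₁ xtz = ⊥-elim (IsGP⇒GeodesicFree gp (S⊆T x∈S) t∈T (S⊆T z∈S) xtz)
  ...     | z , z∈S , inj₂ txz = ⊥-elim (IsGP⇒GeodesicFree gp t∈T (S⊆T x∈S) (S⊆T z∈S) txz)

  certified-maximalGP : 5 ≤ n → (S : List (KV n)) → {True (unique? _≟ᵥ_ S)} → {True (geodesicFreeᵃ? S)} →
                        {True (All.all? (blocked? S) (allKV n))} → Unique S × IsMaximalGP S
  certified-maximalGP 5≤n S {u} {gf} {blocked} =
    toWitness u , GeodesicFree⇒IsGP 5≤n (GeodesicFreeᵃ⇒GeodesicFree (toWitness gf)) ,
    all-blocked⇒maximal (toWitness blocked)

short-geodesics⇒IsGP : ∀ {n} → (∀ {u v : KV n} {k} (p : Walk u v k) → IsShortest p → k ≤ 1) →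
                       (S : List (KV n)) → IsGP S
short-geodesics⇒IsGP k≤1 S p shortest x y z _ _ _ x≢y y≢z x≢z x∈p y∈p z∈p =
  ℕ.<⇒≱ (s≤s (s≤s (k≤1 p shortest)))
    (subst (3 ≤_) (length-verts p) (Unique-⊆⇒length≤ _≟ᵥ_ ((x≢y ∷ x≢z ∷ []) ∷ (y≢z ∷ []) ∷ [] ∷ [])
                                                     (⊆-triple x∈p y∈p z∈p)))

K[3,2]-edgeless : ∀ {u v : KV 3} → ¬ Adj u v
K[3,2]-edgeless {u} {v} (ff , fs , sf , ss) =
  ℕ.<⇒≱ ℕ.≤-refl (Unique⇒length≤ (distinct₄ (fst≢snd u) ff fs sf ss (fst≢snd v)))

K[4,2]-perfect-matching : ∀ {u w w′ : KV 4} → Adj u w → Adj w w′ → w′ ≡ u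
K[4,2]-perfect-matching {u} {w} {w′} u~w w~w′ = ⊆⇒≡ w′⊆u
  where
  w′⊆u : ∀ {t} → w′ ∋ t → u ∋ t
  w′⊆u {t} w′∋t with u ∋? t
  ... | yes u∋t = u∋t
  ... | no  u∌t = contradiction (Unique⇒length≤ uwt-unique) (ℕ.<⇒≱ ℕ.≤-refl)
    where
    u≢w : ∀ {a b} → u ∋ a → w ∋ b → a ≢ b
    u≢w = ¬Meets⇒∋≢ (Adj⇒¬Meets u~w)
    w≢t : ∀ {a} → w ∋ a → a ≢ t
    w≢t w∋a = ¬Meets⇒∋≢ (Adj⇒¬Meets w~w′) w∋a w′∋t
    uwt-unique : Unique (fst u ∷ snd u ∷ fst w ∷ snd w ∷ t ∷ [])
    uwt-unique = (fst≢snd u ∷ u≢w ∋fst ∋fst ∷ u≢w ∋fst ∋snd ∷ ∌⇒≢ ∋fst u∌t ∷ [])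
               ∷ (u≢w ∋snd ∋fst ∷ u≢w ∋snd ∋snd ∷ ∌⇒≢ ∋snd u∌t ∷ [])
               ∷ (fst≢snd w ∷ w≢t ∋fst ∷ [])
               ∷ (w≢t ∋snd ∷ [])
               ∷ [] ∷ []

shortest⇒length≤1₃ : ∀ {u v : KV 3} {k} (p : Walk u v k) → IsShortest p → k ≤ 1
shortest⇒length≤1₃ stay           _ = z≤n
shortest⇒length≤1₃ {u} (step {w = w} u~w _) _ = contradiction u~w (K[3,2]-edgeless {u} {w})

-- K(4,2) is a perfect matching, so a walk u → w → u → … can be shortened by two steps.
shortest⇒length≤1₄ : ∀ {u v : KV 4} {k} (p : Walk u v k) → IsShortest p → k ≤ 1
shortest⇒length≤1₄ stay          _ = z≤n
shortest⇒length≤1₄ (step _ stay) _ = s≤s z≤n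
shortest⇒length≤1₄ {u} {v} {suc (suc k)} (step {w = w} u~w (step {w = w′} w~w′ p)) shortest =
  contradiction (shortest k (subst (λ r → Walk r v k) (K[4,2]-perfect-matching {u} {w} {w′} u~w w~w′) p))
                (ℕ.1+n≰n ∘ ℕ.≤-trans (ℕ.n≤1+n _))

all-IsGP₃ : (S : List (KV 3)) → IsGP S
all-IsGP₃ = short-geodesics⇒IsGP shortest⇒length≤1₃

all-IsGP₄ : (S : List (KV 4)) → IsGP S
all-IsGP₄ = short-geodesics⇒IsGP shortest⇒length≤1₄

GpMinusIs-intro : ∀ {n m} (S : List (KV n)) → Unique S × IsMaximalGP S → length S ≡ m →
               (∀ T → Unique T → IsMaximalGP T → m ≤ length T) → GpMinusIs n m
GpMinusIs-intro S (uS , maximal) refl lower = (S , uS , maximal , refl) , lower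

GpMinusIs-certified : ∀ {n} (S : List (KV n)) {u : True (unique? _≟ᵥ_ S)} {gf : True (geodesicFreeᵃ? S)}
                      {blocked : True (All.all? (blocked? S) (allKV n))} {5≤n : True (5 ℕ.≤? n)}
                      {|S|≤6 : True (length S ℕ.≤? 6)} {2|S|≤n : True (2 * length S ℕ.≤? n)} →
                      GpMinusIs n (length S)
GpMinusIs-certified S {u} {gf} {blocked} {5≤n} {|S|≤6} {2|S|≤n} =
  GpMinusIs-intro S (certified-maximalGP (toWitness 5≤n) S {u} {gf} {blocked}) refl
    (IsMaximalGP⇒length≥ (toWitness 5≤n) (length S) (toWitness |S|≤6) (toWitness 2|S|≤n))

module _ {n : ℕ} (all-IsGP : (S : List (KV n)) → IsGP S) where
  open import Data.List.Membership.DecPropositional (_≟ᵥ_ {n}) using (_∈?_)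

  GpMinusIs-all-vertices : Unique (allKV n) → GpMinusIs n (length (allKV n))
  GpMinusIs-all-vertices all-unique =
    GpMinusIs-intro (allKV n) (all-unique , all-IsGP _ , λ _ _ _ {t} _ → ∈-allKV t) refl
      λ S _ (_ , maximal) → Unique-⊆⇒length≤ _≟ᵥ_ all-unique λ {v} _ → case v ∈? S of λ where
        (yes v∈S) → v∈S
        (no v∉S)  → ⊥-elim (v∉S (maximal (v ∷ S) (all-IsGP (v ∷ S)) there (here refl)))

star₀₋₄ : List (KV 5)
star₀₋₄ = e₀₁ ∷ e₀₂ ∷ e₀₃ ∷ edge (# 0) (# 4) ∷ []

matching₀₋₅ : ∀ {m} → List (KV (6 + m))
matching₀₋₅ = e₀₁ ∷ e₂₃ ∷ edge (# 4) (# 5) ∷ []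

matching₀₋₇ : ∀ {m} → List (KV (8 + m))
matching₀₋₇ = e₀₁ ∷ e₂₃ ∷ edge (# 4) (# 5) ∷ edge (# 6) (# 7) ∷ []

matching₀₋₉ : ∀ {m} → List (KV (10 + m))
matching₀₋₉ = e₀₁ ∷ e₂₃ ∷ edge (# 4) (# 5) ∷ edge (# 6) (# 7) ∷ edge (# 8) (# 9) ∷ []

gp⁻ : ℕ → ℕ
gp⁻ 3  = 3
gp⁻ 5  = 4
gp⁻ 6  = 3
gp⁻ 7  = 3
gp⁻ 8  = 4
gp⁻ 9  = 4
gp⁻ 10 = 5
gp⁻ 11 = 5
gp⁻ _  = 6

GpMinusIs-gp⁻ : ∀ n → 3 ≤ n → GpMinusIs n (gp⁻ n)
GpMinusIs-gp⁻ 0 ()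
GpMinusIs-gp⁻ 1 (s≤s ())
GpMinusIs-gp⁻ 2 (s≤s (s≤s ()))
GpMinusIs-gp⁻ 3 _  = GpMinusIs-all-vertices all-IsGP₃ (from-yes (unique? _≟ᵥ_ (allKV 3)))
GpMinusIs-gp⁻ 4 _  = GpMinusIs-all-vertices all-IsGP₄ (from-yes (unique? _≟ᵥ_ (allKV 4)))
GpMinusIs-gp⁻ 5 _  =
  GpMinusIs-intro star₀₋₄ (certified-maximalGP ℕ.≤-refl star₀₋₄) refl IsMaximalGP⇒length≥₅
GpMinusIs-gp⁻ 6 _  = GpMinusIs-certified matching₀₋₅
GpMinusIs-gp⁻ 7 _  = GpMinusIs-certified matching₀₋₅
GpMinusIs-gp⁻ 8 _  = GpMinusIs-certified matching₀₋₇
GpMinusIs-gp⁻ 9 _  = GpMinusIs-certified matching₀₋₇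
GpMinusIs-gp⁻ 10 _ = GpMinusIs-certified matching₀₋₉
GpMinusIs-gp⁻ 11 _ = GpMinusIs-certified matching₀₋₉
GpMinusIs-gp⁻ (suc (suc (suc (suc (suc (suc (suc (suc (suc (suc (suc (suc k)))))))))))) _ =
  GpMinusIs-intro K₄ (K₄-unique , K₄-maximalGP 5≤n) refl (IsMaximalGP⇒length≥ 5≤n 6 ℕ.≤-refl (ℕ.m≤m+n 12 k))
  where
  open Frame {12 + k} (# 0 ∷ # 1 ∷ # 2 ∷ # 3 ∷ []) (distinct₄ (λ ()) (λ ()) (λ ()) (λ ()) (λ ()) (λ ()))
  5≤n : 5 ≤ 12 + k
  5≤n = ℕ.m≤m+n 5 (7 + k)

gp⁻≡6 : ∀ n → ¬ (n ≡ 3 ⊎ n ≡ 5 ⊎ n ≡ 6 ⊎ n ≡ 7 ⊎ n ≡ 8 ⊎ n ≡ 9 ⊎ n ≡ 10 ⊎ n ≡ 11) → gp⁻ n ≡ 6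
gp⁻≡6 0  _     = refl
gp⁻≡6 1  _     = refl
gp⁻≡6 2  _     = refl
gp⁻≡6 3  small = ⊥-elim (small (inj₁ refl))
gp⁻≡6 4  _     = refl
gp⁻≡6 5  small = ⊥-elim (small (inj₂ (inj₁ refl)))
gp⁻≡6 6  small = ⊥-elim (small (inj₂ (inj₂ (inj₁ refl))))
gp⁻≡6 7  small = ⊥-elim (small (inj₂ (inj₂ (inj₂ (inj₁ refl)))))
gp⁻≡6 8  small = ⊥-elim (small (inj₂ (inj₂ (inj₂ (inj₂ (inj₁ refl))))))
gp⁻≡6 9  small = ⊥-elim (small (inj₂ (inj₂ (inj₂ (inj₂ (inj₂ (inj₁ refl)))))))
gp⁻≡6 10 small = ⊥-elim (small (inj₂ (inj₂ (inj₂ (inj₂ (inj₂ (inj₂ (inj₁ refl))))))))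
gp⁻≡6 11 small = ⊥-elim (small (inj₂ (inj₂ (inj₂ (inj₂ (inj₂ (inj₂ (inj₂ refl))))))))
gp⁻≡6 (suc (suc (suc (suc (suc (suc (suc (suc (suc (suc (suc (suc _)))))))))))) _ = refl

theorem5p1 : ∀ (n : ℕ) → 3 ≤ n →
    ((n ≡ 3 ⊎ n ≡ 6 ⊎ n ≡ 7) → GpMinusIs n 3) ×
    ((n ≡ 5 ⊎ n ≡ 8 ⊎ n ≡ 9) → GpMinusIs n 4) ×
    ((n ≡ 10 ⊎ n ≡ 11) → GpMinusIs n 5) ×
    (¬ (n ≡ 3 ⊎ n ≡ 5 ⊎ n ≡ 6 ⊎ n ≡ 7 ⊎ n ≡ 8 ⊎ n ≡ 9 ⊎ n ≡ 10 ⊎ n ≡ 11) → GpMinusIs n 6)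
theorem5p1 n 3≤n =
    (λ { (inj₁ refl) → at refl ; (inj₂ (inj₁ refl)) → at refl ; (inj₂ (inj₂ refl)) → at refl })
  , (λ { (inj₁ refl) → at refl ; (inj₂ (inj₁ refl)) → at refl ; (inj₂ (inj₂ refl)) → at refl })
  , (λ { (inj₁ refl) → at refl ; (inj₂ refl) → at refl })
  , at ∘ gp⁻≡6 n
  where
  at : ∀ {m} → gp⁻ n ≡ m → GpMinusIs n m
  at gp⁻n≡m = subst (GpMinusIs n) gp⁻n≡m (GpMinusIs-gp⁻ n 3≤n)
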